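{- $\mathrm{MP}^{\vee}$ is equivalent to the following statement WKL!!!: if $T$ is an infinite decidable binary tree that (1) has at most one path in the weak sense that whenever $\alpha,\beta$ are infinite paths through $T$ then $\alpha=\beta$, and (2) is such that for every infinite subtree it is impossible that it does not admit an infinite path, then $T$ admits an infinite path.
   Context: Work in Bishop-style constructive mathematics: intuitionistic logic with countable and dependent choice; "equivalent" means mutual implication over this base. $\mathrm{MP}^{\vee}$ (disjunctive Markov's principle): for every real $x$ with $\neg\neg(0<x)$, for every real $y$ we have $\neg\neg(0<y)\vee\neg\neg(y<x)$. A decidable binary tree is a decidable subset $T$ of the finite binary sequences closed under prefixes; it is infinite if it contains sequences of arbitrary length; an infinite path through $T$ is a binary sequence $\alpha$ with $\bar\alpha n\in T$ for all $n$, where $\bar\alpha n$ is the prefix of length $n$. -}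

module Defs where

open import Data.Nat using (ℕ; zero; suc)
open import Data.Integer using (+_)
open import Data.Rational.Properties using (nonNegative⁻¹; nonNeg+nonNeg⇒nonNeg; normalize-nonNeg)
open import Data.Rational using (ℚ; _-_; _+_; _/_; ∣_∣; 0ℚ) renaming (_≤_ to _≤ℚ_; _<_ to _<ℚ_)
open import Data.Bool using (Bool; true)
open import Data.List using (List; []; _∷_; _∷ʳ_; length)
open import Data.Product using (Σ; _×_; ∃)
open import Data.Sum using (_⊎_)
open import Relation.Nullary using (¬_)
open import Relation.Binary.PropositionalEquality using (_≡_)

-- Bishop real numbers: regular sequences of rationals.
-- The sequence is indexed from 0, index k standing for Bishop's index k+1,
-- so regularity reads |x_m - x_n| ≤ 1/(m+1) + 1/(n+1).

record ℝ : Set where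
  field
    seq : ℕ → ℚ
    reg : ∀ m n → ∣ seq m - seq n ∣ ≤ℚ (+ 1 / suc m) + (+ 1 / suc n)
open ℝ public

_<ℝ_ : ℝ → ℝ → Set
x <ℝ y = ∃ λ k → (+ 2 / suc k) <ℚ (seq y k - seq x k)

0ℝ : ℝ
0ℝ = record { seq = λ _ → 0ℚ ; reg = λ m n → nonNegative⁻¹ (a m + a n) {{nonNeg+nonNeg⇒nonNeg (a m) {{normalize-nonNeg 1 (suc m)}} (a n) {{normalize-nonNeg 1 (suc n)}}}} }
  where
  a : ℕ → ℚ
  a k = + 1 / suc k

MP∨ : Set
MP∨ = (x : ℝ) → ¬ ¬ (0ℝ <ℝ x) → (y : ℝ) → ¬ ¬ (0ℝ <ℝ y) ⊎ ¬ ¬ (y <ℝ x)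

BinTree : Set
BinTree = List Bool → Bool

_∈T_ : List Bool → BinTree → Set
u ∈T T = T u ≡ true

-- closed under prefixes (it suffices to close under one-step prefixes)
PrefixClosed : BinTree → Set
PrefixClosed T = ∀ u b → (u ∷ʳ b) ∈T T → u ∈T T

IsTree : BinTree → Set
IsTree T = PrefixClosed T

Infinite : BinTree → Set
Infinite T = ∀ n → ∃ λ u → length u ≡ n × u ∈T T

prefix : (ℕ → Bool) → ℕ → List Bool
prefix α zero    = []
prefix α (suc n) = prefix α n ∷ʳ α n

IsPath : BinTree → (ℕ → Bool) → Set
IsPath T α = ∀ n → prefix α n ∈T T

HasPath : BinTree → Set
HasPath T = ∃ λ α → IsPath T α

_⊆T_ : BinTree → BinTree → Set
S ⊆T T = ∀ u → u ∈T S → u ∈T T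

-- (1) at most one path, in the weak sense (equality of sequences is pointwise)
AtMostOnePath : BinTree → Set
AtMostOnePath T = ∀ α β → IsPath T α → IsPath T β → ∀ n → α n ≡ β n

SubtreesNotPathless : BinTree → Set
SubtreesNotPathless T = ∀ S → IsTree S → S ⊆T T → Infinite S → ¬ ¬ HasPath S

WKL!!! : Set
WKL!!! = ∀ T → IsTree T → Infinite T → AtMostOnePath T → SubtreesNotPathless T → HasPath T

-- MP∨ ⇔ WKL!!!, proved through the disjunctive Markov principle for binary
-- sequences, MP∨-seq: if α, β : ℕ → Bool are not both identically false, then
-- ¬¬∃n.α n ∨ ¬¬∃n.β n.  The common tool is the first hit k of a binary
-- sequence γ (the least k with γ k), observed from stage k+1 on.
--  * MP∨-seq ⇒ MP∨: test α n = [2/(n+1) < y_n] and β n = [2/(n+1) < x_n - y_n];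
--    if both vanish then x ≤ 0.  MP∨ ⇒ MP∨-seq: with k the first hit of α ∨ β,
--    let the real x latch onto 1/(k+1), and y onto x or 0 according as α k.
--  * WKL!!! ⇒ MP∨-seq: the tree of the constant sequences 0⋯0 and 1⋯1, where
--    at the first hit k branch 0 survives iff α k and branch 1 iff ¬α k.
--  * MP∨-seq ⇒ WKL!!!: two children of a node cannot both be infinite (their
--    cones would not fail to have paths, and these differ), so MP∨-seq applied
--    to the "child dies" sequences selects a not-not-infinite child; iterate.
module Submission where

open import Defs
open import Data.Nat as ℕ using (ℕ; zero; suc; _≤_; _<_; _≤′_; ≤′-refl; ≤′-step; s≤s)
import Data.Nat.Properties as ℕP
open import Data.Nat.Tactic.RingSolver as ℕSolver using ()
open import Data.Integer as ℤ using (+_; -[1+_])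
open import Data.Integer.Properties using (pos-*; pos-+)
open import Data.Integer.Tactic.RingSolver as ℤSolver using ()
open import Data.Rational using (ℚ; mkℚ; 0ℚ; _+_; _-_; -_; ∣_∣; _/_; toℚᵘ; _<?_)
  renaming (_≤_ to _≤ℚ_; _<_ to _<ℚ_)
import Data.Rational.Properties as ℚP
open import Data.Rational.Solver using (module +-*-Solver)
import Data.Rational.Unnormalised as ℚᵘ
import Data.Rational.Unnormalised.Properties as ℚᵘP
open import Data.Bool using (Bool; true; false; not; _∨_; _∧_; if_then_else_)
import Data.Bool as Bool
open import Data.Bool.Properties using (∨-zeroʳ; ∨-identityʳ; ¬-not; not-injective)
open import Data.List using (List; []; _∷_; _∷ʳ_; _++_; length; take; drop; replicate)
open import Data.List.Properties using (++-assoc; ++-identityʳ; length-++; length-take; take++drop≡id; length-replicate; ∷ʳ-injective)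
import Data.List.Properties as ListP
open import Data.Maybe using (Maybe; just; nothing)
open import Data.Product using (Σ; ∃; _×_; _,_; proj₁; proj₂)
open import Data.Sum using (_⊎_; inj₁; inj₂)
import Data.Sum as Sum
open import Data.Empty using (⊥; ⊥-elim)
open import Relation.Nullary using (¬_; Dec; yes; no; does)
open import Relation.Nullary.Decidable using (dec-true)
open import Relation.Binary.PropositionalEquality
open import Function using (_∘_)

decided : ∀ {P : Set} (d : Dec P) → does d ≡ true → P
decided (yes p) _ = p
decided (no _) ()

refuted : ∀ {P : Set} (d : Dec P) → does d ≡ false → ¬ P
refuted (yes _) ()
refuted (no ¬p) _ = ¬p

false≢true : false ≢ true
false≢true ()

nothing≢just : ∀ {A : Set} {x : A} → nothing ≢ just x
nothing≢just ()

∨-split : ∀ {x y} → x ∨ y ≡ true → x ≡ true ⊎ y ≡ true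
∨-split {true}  _ = inj₁ refl
∨-split {false} e = inj₂ e

∨-introˡ : ∀ {x} y → x ≡ true → x ∨ y ≡ true
∨-introˡ y refl = refl

∨-introʳ : ∀ x {y} → y ≡ true → x ∨ y ≡ true
∨-introʳ x refl = ∨-zeroʳ x

∧-split : ∀ {x y} → x ∧ y ≡ true → x ≡ true × y ≡ true
∧-split {true} e = refl , e

∧-intro : ∀ {x y} → x ≡ true → y ≡ true → x ∧ y ≡ true
∧-intro refl refl = refl

AllFalse : (ℕ → Bool) → Set
AllFalse α = ∀ n → α n ≡ false

Hit : (ℕ → Bool) → Set
Hit α = ∃ λ n → α n ≡ true

MP∨-seq : Set
MP∨-seq = ∀ α β → ¬ (AllFalse α × AllFalse β) → ¬ ¬ Hit α ⊎ ¬ ¬ Hit β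

noHit⇒allFalse : ∀ α → ¬ Hit α → AllFalse α
noHit⇒allFalse α nh n with α n in e
... | false = refl
... | true  = ⊥-elim (nh (n , e))

¬¬hit-∨ : ∀ α β → ¬ (AllFalse α × AllFalse β) → ¬ ¬ Hit (λ n → α n ∨ β n)
¬¬hit-∨ α β H nh =
  H ( noHit⇒allFalse α (λ (n , e) → nh (n , ∨-introˡ (β n) e))
    , noHit⇒allFalse β (λ (n , e) → nh (n , ∨-introʳ (α n) e)) )

latch : Maybe ℕ → Bool → ℕ → Maybe ℕ
latch (just k) _     _ = just k
latch nothing  true  n = just n
latch nothing  false _ = nothing

firstHit : (ℕ → Bool) → ℕ → Maybe ℕ
firstHit γ zero    = nothing
firstHit γ (suc n) = latch (firstHit γ n) (γ n) n

module _ (γ : ℕ → Bool) where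

  firstHit-stable : ∀ {m n k} → m ≤ n → firstHit γ m ≡ just k → firstHit γ n ≡ just k
  firstHit-stable m≤n = go (ℕP.≤⇒≤′ m≤n)
    where
    go : ∀ {m n k} → m ≤′ n → firstHit γ m ≡ just k → firstHit γ n ≡ just k
    go ≤′-refl        e = e
    go (≤′-step m≤′n) e rewrite go m≤′n e = refl

  firstHit-sound : ∀ {n k} → firstHit γ n ≡ just k → γ k ≡ true × firstHit γ (suc k) ≡ just k
  firstHit-sound {suc n} e with firstHit γ n in before
  ... | just _ with refl ← e = firstHit-sound {n} before
  ... | nothing with γ n in hit
  ...   | true with refl ← e = hit , cong₂ (λ m b → latch m b n) before hit
  ...   | false with () ← e

  firstHit-complete : ∀ {n} → γ n ≡ true → ∃ λ k → firstHit γ (suc n) ≡ just k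
  firstHit-complete {n} hit with firstHit γ n
  ... | just k  = k , refl
  ... | nothing rewrite hit = n , refl

  firstHit-late : ∀ {m n k} → firstHit γ m ≡ nothing → firstHit γ n ≡ just k → m ≤ k
  firstHit-late {m} {n} {k} unseen seen with suc k ℕ.≤? m
  ... | no  k≮m = ℕP.≤-pred (ℕP.≰⇒> k≮m)
  ... | yes k<m with () ← trans (sym unseen) (firstHit-stable k<m (proj₂ (firstHit-sound {n} seen)))

frac : ℕ → ℕ → ℚ
frac a b = + a / suc b

frac-toℚᵘ : ∀ a b → toℚᵘ (frac a b) ℚᵘ.≃ ℚᵘ.mkℚᵘ (+ a) b
frac-toℚᵘ a b = ℚP.toℚᵘ-fromℚᵘ (ℚᵘ.mkℚᵘ (+ a) b)

frac-≤ : ∀ a b c d → a ℕ.* suc d ≤ c ℕ.* suc b → frac a b ≤ℚ frac c d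
frac-≤ a b c d le = ℚP.toℚᵘ-cancel-≤
  (ℚᵘP.≤-respˡ-≃ (ℚᵘP.≃-sym (frac-toℚᵘ a b)) (ℚᵘP.≤-respʳ-≃ (ℚᵘP.≃-sym (frac-toℚᵘ c d))
    (ℚᵘ.*≤* (subst₂ ℤ._≤_ (pos-* a (suc d)) (pos-* c (suc b)) (ℤ.+≤+ le)))))

frac-< : ∀ a b c d → a ℕ.* suc d < c ℕ.* suc b → frac a b <ℚ frac c d
frac-< a b c d lt = ℚP.toℚᵘ-cancel-<
  (ℚᵘP.<-respˡ-≃ (ℚᵘP.≃-sym (frac-toℚᵘ a b)) (ℚᵘP.<-respʳ-≃ (ℚᵘP.≃-sym (frac-toℚᵘ c d))
    (ℚᵘ.*<* (subst₂ ℤ._<_ (pos-* a (suc d)) (pos-* c (suc b)) (ℤ.+<+ lt)))))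

frac-≡ : ∀ a b c d → a ℕ.* suc d ≡ c ℕ.* suc b → frac a b ≡ frac c d
frac-≡ a b c d eq = ℚP.≤-antisym (frac-≤ a b c d (ℕP.≤-reflexive eq)) (frac-≤ c d a b (ℕP.≤-reflexive (sym eq)))

frac-+ : ∀ a c b → frac a b + frac c b ≡ frac (a ℕ.+ c) b
frac-+ a c b = ℚP.toℚᵘ-injective
  (ℚᵘP.≃-trans (ℚP.toℚᵘ-homo-+ (frac a b) (frac c b))
  (ℚᵘP.≃-trans (ℚᵘP.+-cong (frac-toℚᵘ a b) (frac-toℚᵘ c b))
  (ℚᵘP.≃-trans (ℚᵘ.*≡* cross) (ℚᵘP.≃-sym (frac-toℚᵘ (a ℕ.+ c) b)))))
  where
  cross : (+ a ℤ.* + suc b ℤ.+ + c ℤ.* + suc b) ℤ.* + suc b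
        ≡ + (a ℕ.+ c) ℤ.* + (suc b ℕ.* suc b)
  cross rewrite pos-+ a c | pos-* (suc b) (suc b) = distrib (+ a) (+ c) (+ suc b)
    where
    distrib : ∀ A C S → (A ℤ.* S ℤ.+ C ℤ.* S) ℤ.* S
                      ≡ (A ℤ.+ C) ℤ.* (S ℤ.* S)
    distrib = ℤSolver.solve-∀

frac-nonNeg : ∀ a b → 0ℚ ≤ℚ frac a b
frac-nonNeg a b = ℚP.nonNegative⁻¹ _ {{ℚP.normalize-nonNeg a (suc b)}}

p≤p+q : ∀ p {q} → 0ℚ ≤ℚ q → p ≤ℚ p + q
p≤p+q p {q} 0≤q = subst (_≤ℚ p + q) (ℚP.+-identityʳ p) (ℚP.+-monoʳ-≤ p 0≤q)

modulus-nonNeg : ∀ m n → 0ℚ ≤ℚ frac 1 m + frac 1 n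
modulus-nonNeg m n = ℚP.≤-trans (frac-nonNeg 1 m) (p≤p+q (frac 1 m) (frac-nonNeg 1 n))

frac-antitone : ∀ a {m n} → m ≤ n → frac a n ≤ℚ frac a m
frac-antitone a m≤n = frac-≤ a _ a _ (ℕP.*-monoʳ-≤ a (s≤s m≤n))

-- 1/(k+1) + 5/(5k+5) = 2/(k+1): the bookkeeping of the modulus in MP∨-seq ⇒ MP∨.
fifth-budget : ∀ k → let n = 4 ℕ.+ 5 ℕ.* k in
  (frac 1 k + frac 1 n) + (frac 2 n + frac 2 n) ≡ frac 2 k
fifth-budget k = begin
  (frac 1 k + frac 1 n) + (frac 2 n + frac 2 n)
    ≡⟨ cong₂ (λ p q → (p + frac 1 n) + q) (frac-≡ 1 k 5 n (one-fifth k)) (frac-+ 2 2 n) ⟩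
  (frac 5 n + frac 1 n) + frac 4 n  ≡⟨ cong (_+ frac 4 n) (frac-+ 5 1 n) ⟩
  frac 6 n + frac 4 n               ≡⟨ frac-+ 6 4 n ⟩
  frac 10 n                         ≡⟨ frac-≡ 10 n 2 k (two-fifths k) ⟩
  frac 2 k                          ∎
  where
  open ≡-Reasoning
  n = 4 ℕ.+ 5 ℕ.* k
  one-fifth : ∀ k → 1 ℕ.* suc (4 ℕ.+ 5 ℕ.* k) ≡ 5 ℕ.* suc k
  one-fifth = ℕSolver.solve-∀
  two-fifths : ∀ k → 10 ℕ.* suc k ≡ 2 ℕ.* suc (4 ℕ.+ 5 ℕ.* k)
  two-fifths = ℕSolver.solve-∀

p≤∣p∣ : ∀ p → p ≤ℚ ∣ p ∣
p≤∣p∣ (mkℚ (+ _) _ _)      = ℚP.≤-refl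
p≤∣p∣ p@(mkℚ -[1+ _ ] _ _) = ℚP.<⇒≤ (ℚP.<-≤-trans (ℚP.negative⁻¹ p) (ℚP.0≤∣p∣ p))

∣p-q∣-sym : ∀ p q → ∣ p - q ∣ ≡ ∣ q - p ∣
∣p-q∣-sym p q = trans (sym (ℚP.∣-p∣≡∣p∣ (p - q))) (cong ∣_∣ (solve 2 (λ p q → :- (p :- q) := q :- p) refl p q))
  where open +-*-Solver

telescope : ∀ a b c d → a - d ≡ (a - b) + ((b - c) + (c - d))
telescope = solve 4 (λ a b c d → a :- d := (a :- b) :+ ((b :- c) :+ (c :- d))) refl
  where open +-*-Solver

not-below-diagonal : ∀ {q} p → 0ℚ ≤ℚ q → ¬ q <ℚ p - p
not-below-diagonal {q} p 0≤q q<0 =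
  ℚP.<-irrefl refl (ℚP.<-≤-trans (subst (q <ℚ_) (ℚP.+-inverseʳ p) q<0) 0≤q)

value : (ℕ → Bool) → Maybe ℕ → ℚ
value δ nothing  = 0ℚ
value δ (just k) = if δ k then frac 1 k else 0ℚ

-- Regularity, for m ≤ n: either the value is latched by stage m, or it
-- jumps from 0 to 1/(k+1) with m ≤ k.
latch-regular : ∀ γ δ {m n} → m ≤ n →
  ∣ value δ (firstHit γ m) - value δ (firstHit γ n) ∣ ≤ℚ frac 1 m + frac 1 n
latch-regular γ δ {m} {n} m≤n with firstHit γ m in seenₘ
... | just k rewrite firstHit-stable γ m≤n seenₘ | ℚP.+-inverseʳ (value δ (just k)) = modulus-nonNeg m n
... | nothing with firstHit γ n in seenₙ
...   | nothing rewrite ℚP.+-inverseʳ 0ℚ = modulus-nonNeg m n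
...   | just k with δ k
...     | false rewrite ℚP.+-inverseʳ 0ℚ = modulus-nonNeg m n
...     | true = begin
  ∣ 0ℚ - frac 1 k ∣  ≡⟨ cong ∣_∣ (ℚP.+-identityˡ (- frac 1 k)) ⟩
  ∣ - frac 1 k ∣     ≡⟨ ℚP.∣-p∣≡∣p∣ (frac 1 k) ⟩
  ∣ frac 1 k ∣       ≡⟨ ℚP.0≤p⇒∣p∣≡p (frac-nonNeg 1 k) ⟩
  frac 1 k           ≤⟨ frac-antitone 1 (firstHit-late γ {m} {n} seenₘ seenₙ) ⟩
  frac 1 m           ≤⟨ p≤p+q (frac 1 m) (frac-nonNeg 1 n) ⟩
  frac 1 m + frac 1 n ∎
  where open ℚP.≤-Reasoning

latchReal : (ℕ → Bool) → (ℕ → Bool) → ℝ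
latchReal γ δ = record { seq = λ n → value δ (firstHit γ n) ; reg = regular }
  where
  regular : ∀ m n → ∣ value δ (firstHit γ m) - value δ (firstHit γ n) ∣ ≤ℚ frac 1 m + frac 1 n
  regular m n with ℕP.≤-total m n
  ... | inj₁ m≤n = latch-regular γ δ {m} {n} m≤n
  ... | inj₂ n≤m = subst₂ _≤ℚ_ (∣p-q∣-sym (value δ (firstHit γ n)) (value δ (firstHit γ m)))
                                 (ℚP.+-comm (frac 1 n) (frac 1 m)) (latch-regular γ δ {n} {m} n≤m)

-- A first hit k with δ k makes the latched real positive: at stage
-- j = 2k+2 it equals 1/(k+1) > 2/(j+1).
latch-positive : ∀ γ δ {n k} → firstHit γ n ≡ just k → δ k ≡ true → 0ℝ <ℝ latchReal γ δ
latch-positive γ δ {n} {k} seen δk = j , subst (frac 2 j <ℚ_) (sym value-at-j) margin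
  where
  j = suc (suc (k ℕ.+ k))
  seenⱼ : firstHit γ j ≡ just k
  seenⱼ = firstHit-stable γ (s≤s (ℕP.m≤n⇒m≤1+n (ℕP.m≤m+n k k))) (proj₂ (firstHit-sound γ {n} seen))
  value-at-j : value δ (firstHit γ j) - 0ℚ ≡ frac 1 k
  value-at-j rewrite seenⱼ | δk = ℚP.+-identityʳ (frac 1 k)
  double : ∀ k → suc (2 ℕ.* suc k) ≡ 1 ℕ.* suc (suc (suc (k ℕ.+ k)))
  double = ℕSolver.solve-∀
  margin : frac 2 j <ℚ frac 1 k
  margin = frac-< 2 j 1 k (subst (2 ℕ.* suc k <_) (double k) (ℕP.n<1+n (2 ℕ.* suc k)))

value-positive : ∀ δ m {q} → 0ℚ ≤ℚ q → q <ℚ value δ m - 0ℚ → ∃ λ k → m ≡ just k × δ k ≡ true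
value-positive δ nothing  0≤q lt = ⊥-elim (not-below-diagonal 0ℚ 0≤q lt)
value-positive δ (just k) 0≤q lt with δ k in δk
... | true  = k , refl , δk
... | false = ⊥-elim (not-below-diagonal 0ℚ 0≤q lt)

value-gap : ∀ δ m {q} → 0ℚ ≤ℚ q → q <ℚ value (λ _ → true) m - value δ m → ∃ λ k → m ≡ just k × δ k ≡ false
value-gap δ nothing  0≤q lt = ⊥-elim (not-below-diagonal 0ℚ 0≤q lt)
value-gap δ (just k) 0≤q lt with δ k in δk
... | false = k , refl , δk
... | true  = ⊥-elim (not-below-diagonal (frac 1 k) 0≤q lt)

¬¬-map : ∀ {A B : Set} → (A → B) → ¬ ¬ A → ¬ ¬ B
¬¬-map f ¬¬a ¬b = ¬¬a (λ a → ¬b (f a))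

hit-decided : ∀ {P : ℕ → Set} (P? : ∀ n → Dec (P n)) → Hit (λ n → does (P? n)) → ∃ P
hit-decided P? (n , e) = n , decided (P? n) e

-- If y_n ≤ 2/(n+1) and x_n - y_n ≤ 2/(n+1) for all n, then x is not positive:
-- at n = 5k+4,  x_k ≤ |x_k - x_n| + (x_n - y_n) + y_n ≤ 2/(k+1).
bounded⇒¬positive : ∀ x y → (∀ n → seq y n - 0ℚ ≤ℚ frac 2 n) → (∀ n → seq x n - seq y n ≤ℚ frac 2 n) →
  ¬ (0ℝ <ℝ x)
bounded⇒¬positive x y y-small gap-small (k , lt) = ℚP.<-irrefl refl (ℚP.<-≤-trans lt (begin
  seq x k - 0ℚ
    ≡⟨ telescope (seq x k) (seq x n) (seq y n) 0ℚ ⟩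
  (seq x k - seq x n) + ((seq x n - seq y n) + (seq y n - 0ℚ))
    ≤⟨ ℚP.+-mono-≤ (ℚP.≤-trans (p≤∣p∣ _) (reg x k n)) (ℚP.+-mono-≤ (gap-small n) (y-small n)) ⟩
  (frac 1 k + frac 1 n) + (frac 2 n + frac 2 n)
    ≡⟨ fifth-budget k ⟩
  frac 2 k ∎))
  where
  open ℚP.≤-Reasoning
  n = 4 ℕ.+ 5 ℕ.* k

mp∨-seq⇒mp∨ : MP∨-seq → MP∨
mp∨-seq⇒mp∨ mp x ¬¬0<x y = Sum.map (¬¬-map (hit-decided y-big?)) (¬¬-map (hit-decided gap-big?))
                                   (mp (λ n → does (y-big? n)) (λ n → does (gap-big? n)) not-both-small)
  where
  y-big? : ∀ n → Dec (frac 2 n <ℚ seq y n - 0ℚ)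
  y-big? n = frac 2 n <? (seq y n - 0ℚ)
  gap-big? : ∀ n → Dec (frac 2 n <ℚ seq x n - seq y n)
  gap-big? n = frac 2 n <? (seq x n - seq y n)
  not-both-small : ¬ (AllFalse (λ n → does (y-big? n)) × AllFalse (λ n → does (gap-big? n)))
  not-both-small (y-small , gap-small) = ¬¬0<x (bounded⇒¬positive x y
    (λ n → ℚP.≮⇒≥ (refuted (y-big? n) (y-small n)))
    (λ n → ℚP.≮⇒≥ (refuted (gap-big? n) (gap-small n))))

-- For α, β let γ = α ∨ β with first hit k; x = 1/(k+1), and y = x if α k,
-- y = 0 otherwise.  Then 0 < y yields a hit of α, and y < x one of β.
mp∨⇒mp∨-seq : MP∨ → MP∨-seq
mp∨⇒mp∨-seq mp α β H = Sum.map (¬¬-map hitα) (¬¬-map hitβ) (mp x ¬¬0<x y)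
  where
  γ : ℕ → Bool
  γ n = α n ∨ β n
  x y : ℝ
  x = latchReal γ (λ _ → true)
  y = latchReal γ α
  ¬¬0<x : ¬ ¬ (0ℝ <ℝ x)
  ¬¬0<x = ¬¬-map (λ (n , hit) → latch-positive γ (λ _ → true) (proj₂ (firstHit-complete γ hit)) refl)
                 (¬¬hit-∨ α β H)
  hitα : 0ℝ <ℝ y → Hit α
  hitα (j , lt) with value-positive α (firstHit γ j) (frac-nonNeg 2 j) lt
  ... | k , _ , αk = k , αk
  hitβ : y <ℝ x → Hit β
  hitβ (j , lt) with value-gap α (firstHit γ j) (frac-nonNeg 2 j) lt
  ... | k , seen , ¬αk = k , subst (λ b → b ∨ β k ≡ true) ¬αk (proj₁ (firstHit-sound γ {j} seen))

length-∷ʳ : ∀ {A : Set} (u : List A) x → length (u ∷ʳ x) ≡ suc (length u)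
length-∷ʳ []      x = refl
length-∷ʳ (_ ∷ u) x = cong suc (length-∷ʳ u x)

length-prefix : ∀ α n → length (prefix α n) ≡ n
length-prefix α zero    = refl
length-prefix α (suc n) = trans (length-∷ʳ (prefix α n) (α n)) (cong suc (length-prefix α n))

replicate-∷ʳ : ∀ {A : Set} n (x : A) → replicate n x ∷ʳ x ≡ replicate (suc n) x
replicate-∷ʳ zero    x = refl
replicate-∷ʳ (suc n) x = cong (x ∷_) (replicate-∷ʳ n x)

replicate-++ : ∀ {A : Set} m n (x : A) → replicate (m ℕ.+ n) x ≡ replicate m x ++ replicate n x
replicate-++ zero    n x = refl
replicate-++ (suc m) n x = cong (x ∷_) (replicate-++ m n x)

replicate-init : ∀ {A : Set} (u : List A) y {n x} → u ∷ʳ y ≡ replicate (suc n) x → u ≡ replicate n x × y ≡ x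
replicate-init u y {n} {x} e = ∷ʳ-injective u (replicate n x) (trans e (sym (replicate-∷ʳ n x)))

prefix-constant : ∀ α n {b} → prefix α (suc n) ≡ replicate (suc n) b → α 0 ≡ b × α n ≡ b
prefix-constant α zero    e = let (_ , α0) = replicate-init [] (α 0) e in α0 , α0
prefix-constant α (suc n) e =
  let (init , αn) = replicate-init (prefix α (suc n)) (α (suc n)) e in proj₁ (prefix-constant α n init) , αn

prefix-const : ∀ (b : Bool) m → prefix (λ _ → b) m ≡ replicate m b
prefix-const b zero    = refl
prefix-const b (suc m) = trans (cong (_∷ʳ b) (prefix-const b m)) (replicate-∷ʳ m b)

prefix-closed : ∀ S → IsTree S → ∀ u w → (u ++ w) ∈T S → u ∈T S
prefix-closed S isS u []      h = subst (_∈T S) (++-identityʳ u) h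
prefix-closed S isS u (c ∷ w) h =
  isS u c (prefix-closed S isS (u ∷ʳ c) w (subst (_∈T S) (sym (++-assoc u (c ∷ []) w)) h))

-- For α, β with γ = α ∨ β, the tree contains the constant sequences of
-- value b as long as branch b is alive: always before the first hit k of
-- γ is seen, and afterwards branch false iff α k and branch true iff ¬ α k.

module TwoBranchTree (α β : ℕ → Bool) where

  γ : ℕ → Bool
  γ n = α n ∨ β n

  survives : Maybe ℕ → Bool → Bool
  survives nothing  _     = true
  survives (just k) false = α k
  survives (just k) true  = not (α k)

  alive : Bool → ℕ → Bool
  alive b n = survives (firstHit γ n) b

  isConst : Bool → List Bool → Bool
  isConst b u = does (ListP.≡-dec Bool._≟_ u (replicate (length u) b))

  tree : BinTree
  tree u = (isConst false u ∧ alive false (length u)) ∨ (isConst true u ∧ alive true (length u))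

  alive-down : ∀ b n → alive b (suc n) ≡ true → alive b n ≡ true
  alive-down b n h with firstHit γ n
  ... | nothing = refl
  ... | just k  = h

  alive-some : ∀ n → alive false n ∨ alive true n ≡ true
  alive-some n with firstHit γ n
  ... | nothing = refl
  ... | just k with α k
  ...   | true  = refl
  ...   | false = refl

  alive-both : ∀ n → alive false n ≡ true → alive true n ≡ true → firstHit γ n ≡ nothing
  alive-both n a₀ a₁ with firstHit γ n
  ... | nothing = refl
  ... | just k with α k
  alive-both n a₀ () | just k | true
  alive-both n () a₁ | just k | false

  loser-dies : ∀ {N k} → firstHit γ N ≡ just k → ∀ m → N ≤ m → alive (α k) m ≡ false
  loser-dies {N} {k} seen m N≤m rewrite firstHit-stable γ N≤m seen = loses (α k) refl
    where
    loses : ∀ b → α k ≡ b → survives (just k) b ≡ false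
    loses false αk = αk
    loses true  αk = cong not αk

  member-intro : ∀ b u → u ≡ replicate (length u) b → alive b (length u) ≡ true → u ∈T tree
  member-intro false u e a = ∨-introˡ _ (∧-intro (dec-true (ListP.≡-dec Bool._≟_ u _) e) a)
  member-intro true  u e a = ∨-introʳ (isConst false u ∧ alive false (length u))
                                      (∧-intro (dec-true (ListP.≡-dec Bool._≟_ u _) e) a)

  member-elim : ∀ u → u ∈T tree → Σ Bool λ b → u ≡ replicate (length u) b × alive b (length u) ≡ true
  member-elim u h with ∨-split {isConst false u ∧ alive false (length u)} h
  ... | inj₁ h₀ = let (c , a) = ∧-split h₀ in false , decided (ListP.≡-dec Bool._≟_ u _) c , a
  ... | inj₂ h₁ = let (c , a) = ∧-split h₁ in true  , decided (ListP.≡-dec Bool._≟_ u _) c , a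

  -- The tree is closed under prefixes, since dead branches stay dead.
  isTree : IsTree tree
  isTree u c h with member-elim (u ∷ʳ c) h
  ... | b , e , a = member-intro b u
    (proj₁ (replicate-init u c (trans e (cong (λ l → replicate l b) (length-∷ʳ u c)))))
    (alive-down b (length u) (subst (λ l → alive b l ≡ true) (length-∷ʳ u c) a))

  -- The tree is infinite, since some branch is alive at every stage.
  replicate-member : ∀ b n → alive b n ≡ true → replicate n b ∈T tree
  replicate-member b n a = member-intro b (replicate n b)
    (cong (λ l → replicate l b) (sym (length-replicate n)))
    (subst (λ l → alive b l ≡ true) (sym (length-replicate n)) a)

  infinite : Infinite tree
  infinite n with ∨-split {alive false n} (alive-some n)
  ... | inj₁ a₀ = replicate n false , length-replicate n , replicate-member false n a₀
  ... | inj₂ a₁ = replicate n true  , length-replicate n , replicate-member true  n a₁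

  path-branch : ∀ p → IsPath tree p → ∀ n → p n ≡ p 0 × alive (p 0) n ≡ true
  path-branch p P n with member-elim (prefix p (suc n)) (P (suc n))
  ... | b , e , a with prefix-constant p n (trans e (cong (λ l → replicate l b) (length-prefix p (suc n))))
  ...   | p0≡b , pn≡b rewrite p0≡b =
    pn≡b , alive-down b n (subst (λ l → alive b l ≡ true) (length-prefix p (suc n)) a)

  -- In an infinite subtree, once branch d is dead from stage N on, the
  -- other branch is a path: long nodes of the subtree lie on it.
  constant-path : ∀ S → IsTree S → S ⊆T tree → Infinite S →
    ∀ d N → (∀ m → N ≤ m → alive d m ≡ false) → IsPath S (λ _ → not d)
  constant-path S isS S⊆ infS d N dead m with infS (m ℕ.+ N)
  ... | v , len , v∈S with member-elim v (S⊆ v v∈S)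
  ...   | c , e , a with c Bool.≟ d
  ...     | yes refl = ⊥-elim (false≢true (trans (sym (dead (length v) N≤len)) a))
    where N≤len = subst (N ≤_) (sym len) (ℕP.m≤n+m N m)
  ...     | no c≢d with refl ← ¬-not c≢d = subst (_∈T S) (sym (prefix-const c m))
    (prefix-closed S isS (replicate m c) (replicate N c)
      (subst (_∈T S) (trans e (trans (cong (λ l → replicate l c) len) (replicate-++ m N c))) v∈S))

  module _ (H : ¬ (AllFalse α × AllFalse β)) where

    -- The two branches cannot both stay alive, since γ cannot fail to hit.
    not-both-alive : ∀ b → (∀ n → alive b n ≡ true) → (∀ n → alive (not b) n ≡ true) → ⊥
    not-both-alive false a₀ a₁ = never-both a₀ a₁
      where
      never-both : (∀ n → alive false n ≡ true) → (∀ n → alive true n ≡ true) → ⊥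
      never-both a₀ a₁ = ¬¬hit-∨ α β H λ (n , hit) →
        nothing≢just (trans (sym (alive-both (suc n) (a₀ (suc n)) (a₁ (suc n)))) (proj₂ (firstHit-complete γ hit)))
    not-both-alive true a₁ a₀ = not-both-alive false a₀ a₁

    -- Two paths on different branches would keep both branches alive.
    at-most-one-path : AtMostOnePath tree
    at-most-one-path p q P Q n with p 0 Bool.≟ q 0
    ... | yes same = trans (proj₁ (path-branch p P n)) (trans same (sym (proj₁ (path-branch q Q n))))
    ... | no differ = ⊥-elim (not-both-alive (p 0) (λ m → proj₂ (path-branch p P m))
                                (λ m → subst (λ b → alive b m ≡ true) (¬-not (differ ∘ sym)) (proj₂ (path-branch q Q m))))

    -- Once γ hits with first hit k, branch α k dies, so the other branch is a
    -- path through any infinite subtree.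
    subtrees-not-pathless : SubtreesNotPathless tree
    subtrees-not-pathless S isS S⊆ infS no-path = ¬¬hit-∨ α β H λ (n , hit) →
      let (k , seen) = firstHit-complete γ hit in
      no-path (_ , constant-path S isS S⊆ infS (α k) (suc n) (loser-dies seen))

    path-decides : HasPath tree → ¬ ¬ Hit α ⊎ ¬ ¬ Hit β
    path-decides (p , P) with p 0 | (λ n → proj₂ (path-branch p P n))
    ... | false | alive₀ = inj₁ λ ¬hitα → ¬¬hit-∨ α β H λ (n , hit) →
      let (k , seen) = firstHit-complete γ hit in
      ¬hitα (k , subst (λ m → survives m false ≡ true) seen (alive₀ (suc n)))
    ... | true  | alive₁ = inj₂ λ ¬hitβ → ¬¬hit-∨ α β H λ (n , hit) →
      let (k , seen) = firstHit-complete γ hit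
          ¬αk = not-injective (subst (λ m → survives m true ≡ true) seen (alive₁ (suc n)))
      in ¬hitβ (k , subst (λ b → b ∨ β k ≡ true) ¬αk (proj₁ (firstHit-sound γ {suc n} seen)))

wkl⇒mp∨-seq : WKL!!! → MP∨-seq
wkl⇒mp∨-seq wkl α β H = path-decides H (wkl tree isTree infinite (at-most-one-path H) (subtrees-not-pathless H))
  where open TwoBranchTree α β

comparable : List Bool → List Bool → Bool
comparable []      _       = true
comparable (_ ∷ _) []      = true
comparable (a ∷ v) (b ∷ w) = does (a Bool.≟ b) ∧ comparable v w

comparable-init : ∀ v c w → comparable (v ∷ʳ c) w ≡ true → comparable v w ≡ true
comparable-init []      c w       h = refl
comparable-init (a ∷ v) c []      h = refl
comparable-init (a ∷ v) c (b ∷ w) h = let (a≡b , rest) = ∧-split h in ∧-intro a≡b (comparable-init v c w rest)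

comparable-extension : ∀ w e → comparable (w ++ e) w ≡ true
comparable-extension []      []      = refl
comparable-extension []      (_ ∷ _) = refl
comparable-extension (b ∷ w) e       = ∧-intro (dec-true (b Bool.≟ b) refl) (comparable-extension w e)

comparable-same-length : ∀ v w → length v ≡ length w → comparable v w ≡ true → v ≡ w
comparable-same-length []      []      _   _ = refl
comparable-same-length (a ∷ v) (b ∷ w) len h =
  let (a≡b , rest) = ∧-split h in
  cong₂ _∷_ (decided (a Bool.≟ b) a≡b) (comparable-same-length v w (ℕP.suc-injective len) rest)

module _ (T : BinTree) (isT : IsTree T) where

  extendable : List Bool → ℕ → Bool
  extendable u zero    = T u
  extendable u (suc n) = extendable (u ∷ʳ false) n ∨ extendable (u ∷ʳ true) n

  InfiniteAt : List Bool → Set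
  InfiniteAt u = ∀ n → extendable u n ≡ true

  extendable-child : ∀ u c n → extendable (u ∷ʳ c) n ≡ true → extendable u (suc n) ≡ true
  extendable-child u false n h = ∨-introˡ _ h
  extendable-child u true  n h = ∨-introʳ (extendable (u ∷ʳ false) n) h

  extendable-down : ∀ n u → extendable u (suc n) ≡ true → extendable u n ≡ true
  extendable-down zero u h with ∨-split {extendable (u ∷ʳ false) 0} h
  ... | inj₁ h₀ = isT u false h₀
  ... | inj₂ h₁ = isT u true h₁
  extendable-down (suc n) u h with ∨-split {extendable (u ∷ʳ false) (suc n)} h
  ... | inj₁ h₀ = extendable-child u false n (extendable-down n (u ∷ʳ false) h₀)
  ... | inj₂ h₁ = extendable-child u true  n (extendable-down n (u ∷ʳ true) h₁)

  extendable-≤ : ∀ {m n} u → m ≤ n → extendable u n ≡ true → extendable u m ≡ true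
  extendable-≤ u m≤n = go (ℕP.≤⇒≤′ m≤n)
    where
    go : ∀ {m n} → m ≤′ n → extendable u n ≡ true → extendable u m ≡ true
    go ≤′-refl        h = h
    go (≤′-step {n = n} m≤′n) h = go m≤′n (extendable-down n u h)

  extendable-witness : ∀ n u → extendable u n ≡ true → ∃ λ e → length e ≡ n × (u ++ e) ∈T T
  extendable-witness zero    u h = [] , refl , subst (_∈T T) (sym (++-identityʳ u)) h
  extendable-witness (suc n) u h with ∨-split {extendable (u ∷ʳ false) n} h
  ... | inj₁ h₀ = let (e , len , t) = extendable-witness n (u ∷ʳ false) h₀ in
                  false ∷ e , cong suc len , subst (_∈T T) (++-assoc u (false ∷ []) e) t
  ... | inj₂ h₁ = let (e , len , t) = extendable-witness n (u ∷ʳ true) h₁ in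
                  true ∷ e , cong suc len , subst (_∈T T) (++-assoc u (true ∷ []) e) t

  extendable-intro : ∀ u e → (u ++ e) ∈T T → extendable u (length e) ≡ true
  extendable-intro u []      h = subst (_∈T T) (++-identityʳ u) h
  extendable-intro u (c ∷ e) h =
    extendable-child u c (length e) (extendable-intro (u ∷ʳ c) e (subst (_∈T T) (sym (++-assoc u (c ∷ []) e)) h))

  cone : List Bool → BinTree
  cone w v = T v ∧ comparable v w

  cone-tree : ∀ w → IsTree (cone w)
  cone-tree w v c h = let (t , cmp) = ∧-split h in ∧-intro (isT v c t) (comparable-init v c w cmp)

  cone-⊆ : ∀ w → cone w ⊆T T
  cone-⊆ w v h = proj₁ (∧-split h)

  cone-infinite : ∀ w → InfiniteAt w → Infinite (cone w)
  cone-infinite w inf n with extendable-witness n w (inf n)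
  ... | e , len , t = take n x , length-take-n , prefix-closed (cone w) (cone-tree w) (take n x) (drop n x) x∈cone
    where
    x = w ++ e
    x∈cone : (take n x ++ drop n x) ∈T cone w
    x∈cone = subst (_∈T cone w) (sym (take++drop≡id n x)) (∧-intro t (comparable-extension w e))
    n≤len : n ≤ length x
    n≤len = subst (n ≤_) (sym (trans (length-++ w) (cong (length w ℕ.+_) len))) (ℕP.m≤n+m n (length w))
    length-take-n : length (take n x) ≡ n
    length-take-n = trans (length-take n x) (ℕP.m≤n⇒m⊓n≡m n≤len)

  cone-path : ∀ w p → IsPath (cone w) p → prefix p (length w) ≡ w
  cone-path w p P = comparable-same-length (prefix p (length w)) w (length-prefix p (length w))
                                           (proj₂ (∧-split (P (length w))))

  dead-above : ∀ v {L N} → L ≤ N → extendable v L ≡ false → extendable v N ≡ false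
  dead-above v {L} {N} L≤N dead with extendable v N in alive
  ... | false = refl
  ... | true  = ⊥-elim (false≢true (trans (sym dead) (extendable-≤ v L≤N alive)))

  sibling-infinite : ∀ u b → InfiniteAt u → ∀ L → extendable (u ∷ʳ b) L ≡ false → InfiniteAt (u ∷ʳ not b)
  sibling-infinite u b inf L dead n =
    extendable-≤ (u ∷ʳ not b) (ℕP.m≤m+n n L) (other b (inf (suc N)) (dead-above (u ∷ʳ b) (ℕP.m≤n+m L n) dead))
    where
    N = n ℕ.+ L
    other : ∀ b → extendable u (suc N) ≡ true → extendable (u ∷ʳ b) N ≡ false → extendable (u ∷ʳ not b) N ≡ true
    other false h dead = subst (λ x → x ∨ extendable (u ∷ʳ true) N ≡ true) dead h
    other true  h dead = trans (sym (∨-identityʳ (extendable (u ∷ʳ false) N)))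
                               (subst (λ x → extendable (u ∷ʳ false) N ∨ x ≡ true) dead h)

  root-infinite : Infinite T → InfiniteAt []
  root-infinite inf n = let (e , len , t) = inf n in subst (λ m → extendable [] m ≡ true) len (extendable-intro [] e t)

  -- As T is decidable, a node that is not not infinite lies in T.
  ¬¬infinite⇒member : ∀ u → ¬ ¬ InfiniteAt u → u ∈T T
  ¬¬infinite⇒member u ¬¬inf with T u in member
  ... | true  = refl
  ... | false = ⊥-elim (¬¬inf λ inf → false≢true (trans (sym member) (inf 0)))

  module _ (amo : AtMostOnePath T) (snp : SubtreesNotPathless T) where

    -- The two children of a node are not both infinite: their cones would
    -- not fail to have paths, and these differ at the last entry.
    not-both-children : ∀ u → InfiniteAt (u ∷ʳ false) → InfiniteAt (u ∷ʳ true) → ⊥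
    not-both-children u inf₀ inf₁ =
      snp (cone u₀) (cone-tree u₀) (cone-⊆ u₀) (cone-infinite u₀ inf₀) λ (p₀ , P₀) →
      snp (cone u₁) (cone-tree u₁) (cone-⊆ u₁) (cone-infinite u₁ inf₁) λ (p₁ , P₁) →
      false≢true (trans (sym (last-entry false p₀ P₀))
                 (trans (amo p₀ p₁ (λ n → cone-⊆ u₀ _ (P₀ n)) (λ n → cone-⊆ u₁ _ (P₁ n)) (length u))
                        (last-entry true p₁ P₁)))
      where
      u₀ = u ∷ʳ false
      u₁ = u ∷ʳ true
      last-entry : ∀ b p → IsPath (cone (u ∷ʳ b)) p → p (length u) ≡ b
      last-entry b p P = proj₂ (∷ʳ-injective (prefix p (length u)) u
        (trans (cong (prefix p) (sym (length-∷ʳ u b))) (cone-path (u ∷ʳ b) p P)))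

    module _ (mp : MP∨-seq) where

      -- MP∨-seq, applied to the sequences "child b has died by stage n", picks a
      -- child that is not not infinite.
      choose-child : ∀ u → ¬ ¬ InfiniteAt u → Σ Bool λ b → ¬ ¬ InfiniteAt (u ∷ʳ b)
      choose-child u ¬¬inf with mp (dies false) (dies true)
                                   (λ (alive₀ , alive₁) → not-both-children u (still false alive₀) (still true alive₁))
        where
        dies : Bool → ℕ → Bool
        dies b n = not (extendable (u ∷ʳ b) n)
        still : ∀ b → AllFalse (dies b) → InfiniteAt (u ∷ʳ b)
        still b never n = not-injective (never n)
      ... | inj₁ ¬¬dies₀ = true  , λ ¬inf₁ → ¬¬inf λ inf → ¬¬dies₀ λ (L , e) →
                                     ¬inf₁ (sibling-infinite u false inf L (not-injective e))
      ... | inj₂ ¬¬dies₁ = false , λ ¬inf₀ → ¬¬inf λ inf → ¬¬dies₁ λ (L , e) →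
                                     ¬inf₀ (sibling-infinite u true inf L (not-injective e))

      Node : Set
      Node = Σ (List Bool) λ u → ¬ ¬ InfiniteAt u

      node : Infinite T → ℕ → Node
      node inf zero    = [] , λ ¬inf → ¬inf (root-infinite inf)
      node inf (suc n) = let (u , ¬¬inf) = node inf n in u ∷ʳ proj₁ (choose-child u ¬¬inf) , proj₂ (choose-child u ¬¬inf)

      chosen-path : Infinite T → ℕ → Bool
      chosen-path inf n = proj₁ (choose-child (proj₁ (node inf n)) (proj₂ (node inf n)))

      chosen-path-prefix : ∀ inf n → prefix (chosen-path inf) n ≡ proj₁ (node inf n)
      chosen-path-prefix inf zero    = refl
      chosen-path-prefix inf (suc n) = cong (_∷ʳ chosen-path inf n) (chosen-path-prefix inf n)

      chosen-path-isPath : ∀ inf → IsPath T (chosen-path inf)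
      chosen-path-isPath inf n =
        subst (_∈T T) (sym (chosen-path-prefix inf n)) (¬¬infinite⇒member (proj₁ (node inf n)) (proj₂ (node inf n)))

mp∨-seq⇒wkl : MP∨-seq → WKL!!!
mp∨-seq⇒wkl mp T isT inf amo snp = chosen-path T isT amo snp mp inf , chosen-path-isPath T isT amo snp mp inf

proposition2p3p4 : (MP∨ → WKL!!!) × (WKL!!! → MP∨)
proposition2p3p4 = (λ mp → mp∨-seq⇒wkl (mp∨⇒mp∨-seq mp))
                 , (λ wkl → mp∨-seq⇒mp∨ (wkl⇒mp∨-seq wkl))
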